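{- For all $n\ge1$, the parity-constrained Hanoi graph $P^n$ has a Hamiltonian path between the vertices $0^n$ and $3^n$.
   Context: Let $Q=\{0,1,2,3\}$ (pegs: $0,3$ neutral; $1$ reserved for even discs; $2$ reserved for odd discs). For a disc $d\in\{1,\dots,n\}$ let $p(d)=1$ if $d$ is even and $p(d)=2$ if $d$ is odd, and $Q^d=\{0,p(d),3\}$. The vertices of $P^n$ are words $s=s_n\cdots s_1\in Q^n$ ($s_d$ is the peg of disc $d$) with $s_d\in Q^d$ for all $d$. Two vertices are adjacent iff they differ in exactly one coordinate $d$, with values $i\ne j$ there, $i,j\in Q^d$, and $s_k\notin\{i,j\}$ for all $k<d$. $i^n$ denotes the word with all letters equal to $i$ (all discs on peg $i$). -}

module Defs where

open import Data.Nat using (ℕ; zero; suc)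
open import Data.Fin using (Fin; toℕ; _<_)
open import Data.Vec using (Vec; lookup; replicate)
open import Data.List using (List; []; _∷_; head; last)
open import Data.List.Relation.Unary.All using (All)
open import Data.List.Relation.Unary.Unique.Propositional using (Unique)
open import Data.List.Relation.Unary.Linked using (Linked)
open import Data.List.Membership.Propositional using (_∈_)
open import Data.Maybe using (Maybe; just)
open import Data.Product using (Σ; _×_; ∃-syntax)
open import Data.Sum using (_⊎_)
open import Relation.Binary.PropositionalEquality using (_≡_; _≢_)

Peg : Set
Peg = Fin 4

p0 p1 p2 p3 : Peg
p0 = Data.Fin.zero
p1 = Data.Fin.suc Data.Fin.zero
p2 = Data.Fin.suc (Data.Fin.suc Data.Fin.zero)
p3 = Data.Fin.suc (Data.Fin.suc (Data.Fin.suc Data.Fin.zero))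

-- Convention: a word s = s_n ⋯ s_1 is a vector  s : Vec Peg n  where
-- lookup s i  is the peg of disc  d = toℕ i + 1.

disc : {n : ℕ} → Fin n → ℕ
disc i = suc (toℕ i)

p : ℕ → Peg
p zero = p1
p (suc zero) = p2
p (suc (suc d)) = p d

InQ : ℕ → Peg → Set
InQ d j = (j ≡ p0) ⊎ (j ≡ p d) ⊎ (j ≡ p3)

IsVertex : {n : ℕ} → Vec Peg n → Set
IsVertex {n} s = (i : Fin n) → InQ (disc i) (lookup s i)

Adjacent : {n : ℕ} → Vec Peg n → Vec Peg n → Set
Adjacent {n} s t = ∃[ i ]
  ( lookup s i ≢ lookup t i
  × InQ (disc i) (lookup s i)
  × InQ (disc i) (lookup t i)
  × ((k : Fin n) → k ≢ i → lookup s k ≡ lookup t k)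
  × ((k : Fin n) → k < i → lookup s k ≢ lookup s i × lookup s k ≢ lookup t i))

record HamPath (n : ℕ) (u v : Vec Peg n) : Set where
  field
    path      : List (Vec Peg n)
    vertices  : All IsVertex path
    distinct  : Unique path
    covers    : (s : Vec Peg n) → IsVertex s → s ∈ path
    adjacent  : Linked Adjacent path
    starts    : head path ≡ just u
    ends      : last path ≡ just v

-- Induction on n, building Hamiltonian paths 0ⁿ → 3ⁿ and 3ⁿ → 0ⁿ together. Disc n+1,
-- the last coordinate of a word, lies on a, p(n+1) or b (where {a, b} = {0, 3}), and never
-- blocks a smaller disc, so fixing its peg gives a copy of Pⁿ. Walk the copy with disc n+1
-- on a from aⁿ to bⁿ; with the tower on b, disc n+1 can move to p(n+1); walk back from bⁿ
-- to aⁿ; now disc n+1 can move to b; walk from aⁿ to bⁿ once more.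
module Submission where

open import Defs
open import Data.Nat using (ℕ; zero; suc; _≥_)
open import Data.Nat.Properties using (<⇒≱; <-irrefl)
open import Data.Fin using (Fin; inject₁; fromℕ; _<_)
open import Data.Fin.Properties using (toℕ-inject₁; toℕ-fromℕ; ≤fromℕ)
open import Data.Fin.Relation.Unary.Top using (view; ‵fromℕ; ‵inject₁)
open import Data.Vec using (Vec; []; _∷_; _∷ʳ_; lookup; replicate; initLast)
open import Data.Vec.Properties using (∷ʳ-injectiveˡ; ∷ʳ-injectiveʳ; lookup-replicate)
open import Data.List using (List; map; _++_; head; last)
import Data.List as List
open import Data.List.Properties using (head-map; last-map)
open import Data.List.Relation.Unary.All using (All)
import Data.List.Relation.Unary.All as All
import Data.List.Relation.Unary.All.Properties as All
open import Data.List.Relation.Unary.Any using (here)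
open import Data.List.Relation.Unary.Unique.Propositional using (Unique)
import Data.List.Relation.Unary.Unique.Propositional.Properties as Unique
open import Data.List.Relation.Unary.Linked using (Linked)
import Data.List.Relation.Unary.Linked as Linked
import Data.List.Relation.Unary.Linked.Properties as Linked
open import Data.List.Relation.Binary.Disjoint.Propositional using (Disjoint)
open import Data.List.Membership.Propositional using (_∈_)
open import Data.List.Membership.Propositional.Properties using (∈-map⁺; ∈-map⁻; ∈-++⁺ˡ; ∈-++⁺ʳ; ∈-++⁻)
open import Data.Maybe using (just)
import Data.Maybe as Maybe
open import Data.Maybe.Relation.Binary.Connected using (Connected; just)
open import Data.Product using (_×_; _,_; proj₁)
open import Data.Sum using (_⊎_; inj₁; inj₂)
open import Data.Empty using (⊥-elim)
open import Function using (_∘_)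
open import Relation.Binary.PropositionalEquality

private variable
  n : ℕ
  A B : Set

head-++ : {xs ys : List A} {x : A} → head xs ≡ just x → head (xs ++ ys) ≡ just x
head-++ {xs = _ List.∷ _} e = e

last-++ : (xs : List A) {ys : List A} {y : A} → last ys ≡ just y → last (xs ++ ys) ≡ just y
last-++ List.[]       e = e
last-++ (x List.∷ xs) {ys} e = last-∷ (xs ++ ys) (last-++ xs e)
  where
  last-∷ : (zs : List _) {z : _} → last zs ≡ just z → last (x List.∷ zs) ≡ just z
  last-∷ (_ List.∷ _) e = e

Linked-++⁺ : {R : A → A → Set} {xs ys : List A} {x y : A} → Linked R xs → Linked R ys →
             last xs ≡ just x → head ys ≡ just y → R x y → Linked R (xs ++ ys)
Linked-++⁺ {R = R} Rxs Rys ex ey Rxy = Linked.++⁺ Rxs (subst₂ (Connected R) (sym ex) (sym ey) (just Rxy)) Rys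

Disjoint-++⁺ʳ : {xs ys zs : List A} → Disjoint xs ys → Disjoint xs zs → Disjoint xs (ys ++ zs)
Disjoint-++⁺ʳ {ys = ys} xs#ys xs#zs (v∈xs , v∈ys++zs) with ∈-++⁻ ys v∈ys++zs
... | inj₁ v∈ys = xs#ys (v∈xs , v∈ys)
... | inj₂ v∈zs = xs#zs (v∈xs , v∈zs)

head-map-just : (f : A → B) (xs : List A) {x : A} → head xs ≡ just x → head (map f xs) ≡ just (f x)
head-map-just f xs e = trans (head-map {f = f} xs) (cong (Maybe.map f) e)

last-map-just : (f : A → B) (xs : List A) {x : A} → last xs ≡ just x → last (map f xs) ≡ just (f x)
last-map-just f xs e = trans (last-map f xs) (cong (Maybe.map f) e)

lookup-∷ʳ-inject₁ : {x : A} (xs : Vec A n) (i : Fin n) → lookup (xs ∷ʳ x) (inject₁ i) ≡ lookup xs i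
lookup-∷ʳ-inject₁ (y ∷ xs) Data.Fin.zero    = refl
lookup-∷ʳ-inject₁ (y ∷ xs) (Data.Fin.suc i) = lookup-∷ʳ-inject₁ xs i

lookup-∷ʳ-fromℕ : {x : A} (xs : Vec A n) → lookup (xs ∷ʳ x) (fromℕ n) ≡ x
lookup-∷ʳ-fromℕ []       = refl
lookup-∷ʳ-fromℕ (y ∷ xs) = lookup-∷ʳ-fromℕ xs

replicate-∷ʳ : (n : ℕ) (x : A) → replicate n x ∷ʳ x ≡ replicate (suc n) x
replicate-∷ʳ zero    x = refl
replicate-∷ʳ (suc n) x = cong (x ∷_) (replicate-∷ʳ n x)

map-∷ʳ-disjoint : {a b : A} → a ≢ b → (xs ys : List (Vec A n)) → Disjoint (map (_∷ʳ a) xs) (map (_∷ʳ b) ys)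
map-∷ʳ-disjoint a≢b xs ys (v∈xs , v∈ys) with ∈-map⁻ _ v∈xs | ∈-map⁻ _ v∈ys
... | u , _ , refl | w , _ , v≡w∷ʳb = a≢b (∷ʳ-injectiveʳ u w v≡w∷ʳb)

disc-inject₁ : (i : Fin n) → disc (inject₁ i) ≡ disc i
disc-inject₁ i = cong suc (toℕ-inject₁ i)

disc-fromℕ : (n : ℕ) → disc (fromℕ n) ≡ suc n
disc-fromℕ n = cong suc (toℕ-fromℕ n)

InQ-∷ʳ-inject₁ : {x : Peg} (xs : Vec Peg n) (i : Fin n) →
                 InQ (disc i) (lookup xs i) → InQ (disc (inject₁ i)) (lookup (xs ∷ʳ x) (inject₁ i))
InQ-∷ʳ-inject₁ xs i = subst₂ InQ (sym (disc-inject₁ i)) (sym (lookup-∷ʳ-inject₁ xs i))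

InQ-∷ʳ-fromℕ : {x : Peg} (xs : Vec Peg n) → InQ (suc n) x → InQ (disc (fromℕ n)) (lookup (xs ∷ʳ x) (fromℕ n))
InQ-∷ʳ-fromℕ {n} xs = subst₂ InQ (sym (disc-fromℕ n)) (sym (lookup-∷ʳ-fromℕ xs))

IsVertex-∷ʳ⁺ : {xs : Vec Peg n} {x : Peg} → IsVertex xs → InQ (suc n) x → IsVertex (xs ∷ʳ x)
IsVertex-∷ʳ⁺ {xs = xs} vxs qx k with view k
... | ‵inject₁ i = InQ-∷ʳ-inject₁ xs i (vxs i)
... | ‵fromℕ     = InQ-∷ʳ-fromℕ xs qx

IsVertex-∷ʳ⁻ : {xs : Vec Peg n} {x : Peg} → IsVertex (xs ∷ʳ x) → IsVertex xs × InQ (suc n) x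
IsVertex-∷ʳ⁻ {n} {xs} v =
  (λ i → subst₂ InQ (disc-inject₁ i) (lookup-∷ʳ-inject₁ xs i) (v (inject₁ i))) ,
  subst₂ InQ (disc-fromℕ n) (lookup-∷ʳ-fromℕ xs) (v (fromℕ n))

Adjacent-∷ʳ : {xs ys : Vec Peg n} {x : Peg} → Adjacent xs ys → Adjacent (xs ∷ʳ x) (ys ∷ʳ x)
Adjacent-∷ʳ {n} {xs} {ys} {x} (i , xᵢ≢yᵢ , qxᵢ , qyᵢ , agree , smaller) =
  inject₁ i , xᵢ≢yᵢ ∘ lookup-inject₁ , InQ-∷ʳ-inject₁ xs i qxᵢ , InQ-∷ʳ-inject₁ ys i qyᵢ , agree′ , smaller′
  where
  lookup-inject₁ : lookup (xs ∷ʳ x) (inject₁ i) ≡ lookup (ys ∷ʳ x) (inject₁ i) → lookup xs i ≡ lookup ys i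
  lookup-inject₁ = subst₂ _≡_ (lookup-∷ʳ-inject₁ xs i) (lookup-∷ʳ-inject₁ ys i)

  agree′ : (k : Fin (suc n)) → k ≢ inject₁ i → lookup (xs ∷ʳ x) k ≡ lookup (ys ∷ʳ x) k
  agree′ k k≢i with view k
  ... | ‵inject₁ j = trans (lookup-∷ʳ-inject₁ xs j)
                       (trans (agree j (k≢i ∘ cong inject₁)) (sym (lookup-∷ʳ-inject₁ ys j)))
  ... | ‵fromℕ     = trans (lookup-∷ʳ-fromℕ xs) (sym (lookup-∷ʳ-fromℕ ys))

  smaller′ : (k : Fin (suc n)) → k < inject₁ i →
             lookup (xs ∷ʳ x) k ≢ lookup (xs ∷ʳ x) (inject₁ i) × lookup (xs ∷ʳ x) k ≢ lookup (ys ∷ʳ x) (inject₁ i)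
  smaller′ k k<i with view k
  ... | ‵inject₁ j
    with xⱼ≢xᵢ , xⱼ≢yᵢ ← smaller j (subst₂ Data.Nat._<_ (toℕ-inject₁ j) (toℕ-inject₁ i) k<i)
    = xⱼ≢xᵢ ∘ subst₂ _≡_ (lookup-∷ʳ-inject₁ xs j) (lookup-∷ʳ-inject₁ xs i)
    , xⱼ≢yᵢ ∘ subst₂ _≡_ (lookup-∷ʳ-inject₁ xs j) (lookup-∷ʳ-inject₁ ys i)
  ... | ‵fromℕ = ⊥-elim (<⇒≱ k<i (≤fromℕ (inject₁ i)))

Adjacent-largest : {a b c : Peg} → a ≢ b → InQ (suc n) a → InQ (suc n) b → c ≢ a → c ≢ b →
                   Adjacent (replicate n c ∷ʳ a) (replicate n c ∷ʳ b)
Adjacent-largest {n} {a} {b} {c} a≢b qa qb c≢a c≢b =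
  fromℕ n , a≢b ∘ lookup-fromℕ , InQ-∷ʳ-fromℕ tower qa , InQ-∷ʳ-fromℕ tower qb , agree , smaller
  where
  tower : Vec Peg n
  tower = replicate n c

  lookup-fromℕ : lookup (tower ∷ʳ a) (fromℕ n) ≡ lookup (tower ∷ʳ b) (fromℕ n) → a ≡ b
  lookup-fromℕ = subst₂ _≡_ (lookup-∷ʳ-fromℕ tower) (lookup-∷ʳ-fromℕ tower)

  lookup-tower : {x : Peg} (j : Fin n) → lookup (tower ∷ʳ x) (inject₁ j) ≡ c
  lookup-tower j = trans (lookup-∷ʳ-inject₁ tower j) (lookup-replicate j c)

  agree : (k : Fin (suc n)) → k ≢ fromℕ n → lookup (tower ∷ʳ a) k ≡ lookup (tower ∷ʳ b) k
  agree k k≢n with view k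
  ... | ‵inject₁ j = trans (lookup-tower j) (sym (lookup-tower j))
  ... | ‵fromℕ     = ⊥-elim (k≢n refl)

  smaller : (k : Fin (suc n)) → k < fromℕ n →
            lookup (tower ∷ʳ a) k ≢ lookup (tower ∷ʳ a) (fromℕ n) × lookup (tower ∷ʳ a) k ≢ lookup (tower ∷ʳ b) (fromℕ n)
  smaller k k<n with view k
  ... | ‵inject₁ j = c≢a ∘ subst₂ _≡_ (lookup-tower j) (lookup-∷ʳ-fromℕ tower)
                   , c≢b ∘ subst₂ _≡_ (lookup-tower j) (lookup-∷ʳ-fromℕ tower)
  ... | ‵fromℕ     = ⊥-elim (<-irrefl refl k<n)

Neutral : Peg → Set
Neutral a = a ≡ p0 ⊎ a ≡ p3

p≢p0 : (d : ℕ) → p d ≢ p0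
p≢p0 zero             ()
p≢p0 (suc zero)       ()
p≢p0 (suc (suc d)) e = p≢p0 d e

p≢p3 : (d : ℕ) → p d ≢ p3
p≢p3 zero             ()
p≢p3 (suc zero)       ()
p≢p3 (suc (suc d)) e = p≢p3 d e

Neutral⇒≢p : {a : Peg} (d : ℕ) → Neutral a → a ≢ p d
Neutral⇒≢p d (inj₁ refl) = p≢p0 d ∘ sym
Neutral⇒≢p d (inj₂ refl) = p≢p3 d ∘ sym

Neutral⇒InQ : {a : Peg} (d : ℕ) → Neutral a → InQ d a
Neutral⇒InQ d (inj₁ a≡0) = inj₁ a≡0
Neutral⇒InQ d (inj₂ a≡3) = inj₂ (inj₂ a≡3)

InQ-neutral-cases : {a b x : Peg} (d : ℕ) → a ≢ b → Neutral a → Neutral b → InQ d x → x ≡ a ⊎ x ≡ p d ⊎ x ≡ b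
InQ-neutral-cases d a≢b (inj₁ refl) (inj₁ refl) _ = ⊥-elim (a≢b refl)
InQ-neutral-cases d a≢b (inj₂ refl) (inj₂ refl) _ = ⊥-elim (a≢b refl)
InQ-neutral-cases d a≢b (inj₁ refl) (inj₂ refl) q = q
InQ-neutral-cases d a≢b (inj₂ refl) (inj₁ refl) (inj₁ x≡0)        = inj₂ (inj₂ x≡0)
InQ-neutral-cases d a≢b (inj₂ refl) (inj₁ refl) (inj₂ (inj₁ x≡p)) = inj₂ (inj₁ x≡p)
InQ-neutral-cases d a≢b (inj₂ refl) (inj₁ refl) (inj₂ (inj₂ x≡3)) = inj₁ x≡3

module _ {c : Peg} {xs : List (Vec Peg n)} where

  All-IsVertex-∷ʳ : InQ (suc n) c → All IsVertex xs → All IsVertex (map (_∷ʳ c) xs)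
  All-IsVertex-∷ʳ qc = All.map⁺ ∘ All.map (λ {s} v → IsVertex-∷ʳ⁺ {xs = s} v qc)

  Unique-∷ʳ : Unique xs → Unique (map (_∷ʳ c) xs)
  Unique-∷ʳ = Unique.map⁺ (∷ʳ-injectiveˡ _ _)

  Linked-Adjacent-∷ʳ : Linked Adjacent xs → Linked Adjacent (map (_∷ʳ c) xs)
  Linked-Adjacent-∷ʳ = Linked.map⁺ ∘ Linked.map (λ {s t} → Adjacent-∷ʳ {xs = s} {t})

HamPath-zero : HamPath 0 [] []
HamPath-zero = record
  { path     = [] List.∷ List.[]
  ; vertices = (λ ()) All.∷ All.[]
  ; distinct = All.[] Unique.∷ Unique.[]
  ; covers   = λ { [] _ → here refl }
  ; adjacent = Linked.[-]
  ; starts   = refl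
  ; ends     = refl
  }

module _ {a b : Peg} (a≢b : a ≢ b) (neutral-a : Neutral a) (neutral-b : Neutral b)
         (H : HamPath n (replicate n a) (replicate n b)) (H′ : HamPath n (replicate n b) (replicate n a)) where

  open HamPath

  private
    pₙ₊₁ : Peg
    pₙ₊₁ = p (suc n)

    qa : InQ (suc n) a
    qa = Neutral⇒InQ (suc n) neutral-a

    qb : InQ (suc n) b
    qb = Neutral⇒InQ (suc n) neutral-b

    qₙ₊₁ : InQ (suc n) pₙ₊₁
    qₙ₊₁ = inj₂ (inj₁ refl)

    a≢pₙ₊₁ : a ≢ pₙ₊₁
    a≢pₙ₊₁ = Neutral⇒≢p (suc n) neutral-a

    b≢pₙ₊₁ : b ≢ pₙ₊₁
    b≢pₙ₊₁ = Neutral⇒≢p (suc n) neutral-b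

    first middle final : List (Vec Peg (suc n))
    first  = map (_∷ʳ a) (path H)
    middle = map (_∷ʳ pₙ₊₁) (path H′)
    final  = map (_∷ʳ b) (path H)

    first-starts : head first ≡ just (replicate n a ∷ʳ a)
    first-starts = head-map-just (_∷ʳ a) (path H) (starts H)

    first-ends : last first ≡ just (replicate n b ∷ʳ a)
    first-ends = last-map-just (_∷ʳ a) (path H) (ends H)

    middle-starts : head middle ≡ just (replicate n b ∷ʳ pₙ₊₁)
    middle-starts = head-map-just (_∷ʳ pₙ₊₁) (path H′) (starts H′)

    middle-ends : last middle ≡ just (replicate n a ∷ʳ pₙ₊₁)
    middle-ends = last-map-just (_∷ʳ pₙ₊₁) (path H′) (ends H′)

    final-starts : head final ≡ just (replicate n a ∷ʳ b)
    final-starts = head-map-just (_∷ʳ b) (path H) (starts H)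

    final-ends : last final ≡ just (replicate n b ∷ʳ b)
    final-ends = last-map-just (_∷ʳ b) (path H) (ends H)

    covers-all : (s : Vec Peg (suc n)) → IsVertex s → s ∈ first ++ middle ++ final
    covers-all s v with initLast s
    ... | xs , x , refl with IsVertex-∷ʳ⁻ {xs = xs} {x} v
    ... | vxs , qx with InQ-neutral-cases {x = x} (suc n) a≢b neutral-a neutral-b qx
    ... | inj₁ refl        = ∈-++⁺ˡ (∈-map⁺ _ (covers H xs vxs))
    ... | inj₂ (inj₁ refl) = ∈-++⁺ʳ first (∈-++⁺ˡ (∈-map⁺ _ (covers H′ xs vxs)))
    ... | inj₂ (inj₂ refl) = ∈-++⁺ʳ first (∈-++⁺ʳ middle (∈-map⁺ _ (covers H xs vxs)))

  HamPath-suc : HamPath (suc n) (replicate (suc n) a) (replicate (suc n) b)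
  HamPath-suc = record
    { path     = first ++ middle ++ final
    ; vertices = All.++⁺ (All-IsVertex-∷ʳ qa (vertices H))
                   (All.++⁺ (All-IsVertex-∷ʳ qₙ₊₁ (vertices H′)) (All-IsVertex-∷ʳ qb (vertices H)))
    ; distinct = Unique.++⁺ (Unique-∷ʳ (distinct H))
                   (Unique.++⁺ (Unique-∷ʳ (distinct H′)) (Unique-∷ʳ (distinct H))
                      (map-∷ʳ-disjoint (b≢pₙ₊₁ ∘ sym) (path H′) (path H)))
                   (Disjoint-++⁺ʳ (map-∷ʳ-disjoint a≢pₙ₊₁ (path H) (path H′))
                                  (map-∷ʳ-disjoint a≢b (path H) (path H)))
    ; covers   = covers-all
    ; adjacent = Linked-++⁺ (Linked-Adjacent-∷ʳ (adjacent H))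
                   (Linked-++⁺ (Linked-Adjacent-∷ʳ (adjacent H′)) (Linked-Adjacent-∷ʳ (adjacent H))
                      middle-ends final-starts (Adjacent-largest (b≢pₙ₊₁ ∘ sym) qₙ₊₁ qb a≢pₙ₊₁ a≢b))
                   first-ends (head-++ middle-starts) (Adjacent-largest a≢pₙ₊₁ qa qₙ₊₁ (a≢b ∘ sym) b≢pₙ₊₁)
    ; starts   = trans (head-++ first-starts) (cong just (replicate-∷ʳ n a))
    ; ends     = trans (last-++ first (last-++ middle final-ends)) (cong just (replicate-∷ʳ n b))
    }

HamPath-neutral : (n : ℕ) → HamPath n (replicate n p0) (replicate n p3) × HamPath n (replicate n p3) (replicate n p0)
HamPath-neutral zero    = HamPath-zero , HamPath-zero
HamPath-neutral (suc n) =
  let H , H′ = HamPath-neutral n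
  in HamPath-suc (λ ()) (inj₁ refl) (inj₂ refl) H H′ , HamPath-suc (λ ()) (inj₂ refl) (inj₁ refl) H′ H

-- P⁰ has the single vertex [].
theorem6p19 : (n : ℕ) → n ≥ 1 → HamPath n (replicate n p0) (replicate n p3)
theorem6p19 n _ = proj₁ (HamPath-neutral n)
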